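{- Let $u$ and $v$ be $c$-epichristoffel words over $\mathcal{A}$ such that $|u|_\alpha=|v|_\alpha$ for every letter $\alpha\in\mathcal{A}$. Then $u$ and $v$ are conjugate. In other words, a $k$-tuple of occurrence numbers of letters determines at most one epichristoffel class.
   Context: $\mathcal{A}$ is a finite alphabet with $k$ letters; $|w|_\alpha$ is the number of occurrences of $\alpha$ in $w$. Words $w,w'$ are conjugate if $w=xy$, $w'=yx$ for some words $x,y$. For $a,b\in\mathcal{A}$: $\psi_a(a)=\overline{\psi}_a(a)=a$, $\psi_a(x)=ax$, $\overline{\psi}_a(x)=xa$ for letters $x\neq a$, and $\theta_{ab}$ swaps $a,b$ and fixes other letters; episturmian morphisms are compositions of these. A word is $c$-epichristoffel if it is the image of a letter under an episturmian morphism; an epichristoffel class is the conjugacy class of a $c$-epichristoffel word. -}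

module Defs where

open import Data.Nat using (ℕ)
open import Data.Fin using (Fin; _≟_)
open import Data.List using (List; []; _∷_; [_]; _++_; concatMap; filter; length)
open import Data.Product using (∃; ∃-syntax; _×_)
open import Relation.Nullary using (yes; no)
open import Relation.Binary.PropositionalEquality using (_≡_)

Word : ℕ → Set
Word k = List (Fin k)

Morphism : ℕ → Set
Morphism k = Fin k → Word k

apply : {k : ℕ} → Morphism k → Word k → Word k
apply f w = concatMap f w

ψ : {k : ℕ} → Fin k → Morphism k
ψ a x with x ≟ a
... | yes _ = [ a ]
... | no _  = a ∷ x ∷ []

ψ̄ : {k : ℕ} → Fin k → Morphism k
ψ̄ a x with x ≟ a
... | yes _ = [ a ]
... | no _  = x ∷ a ∷ []

θ : {k : ℕ} → Fin k → Fin k → Morphism k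
θ a b x with x ≟ a
... | yes _ = [ b ]
... | no _ with x ≟ b
...   | yes _ = [ a ]
...   | no _  = [ x ]

data Episturmian {k : ℕ} : Morphism k → Set where
  ep-id  : Episturmian [_]
  ep-ψ   : ∀ {f} (a : Fin k) → Episturmian f → Episturmian (λ x → apply (ψ a) (f x))
  ep-ψ̄   : ∀ {f} (a : Fin k) → Episturmian f → Episturmian (λ x → apply (ψ̄ a) (f x))
  ep-θ   : ∀ {f} (a b : Fin k) → Episturmian f → Episturmian (λ x → apply (θ a b) (f x))

CEpichristoffel : {k : ℕ} → Word k → Set
CEpichristoffel {k} w = ∃[ f ] ∃[ a ] (Episturmian {k} f × w ≡ f a)

occ : {k : ℕ} → Fin k → Word k → ℕ
occ α w = length (filter (_≟ α) w)

Conjugate : {k : ℕ} → Word k → Word k → Set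
Conjugate {k} w w' = ∃[ x ] ∃[ y ] (w ≡ x ++ y × w' ≡ y ++ x)

module Submission where

-- Call a word *standard* if it has the form ψ_{a₁}(⋯ψ_{aₙ}(x)⋯)
-- for a letter x, i.e. it is built using the morphisms ψ_a only.
--   (1) Normal form: every c-epichristoffel word is conjugate to a standard
--       word.  Indeed ψ̄_a(w) is a conjugate of ψ_a(w), morphisms preserve
--       conjugacy, and θ_ab is the letter renaming by the transposition (a b),
--       which commutes with ψ up to renaming the subscript.
--   (2) Uniqueness: two standard words with the same Parikh vector are
--       conjugate.  By induction on the standard forms: if both are
--       ψ_a(w'), ψ_a(v'), the Parikh vectors of w', v' agree and we recurse;
--       if they are ψ_a(w'), ψ_b(v') with a ≠ b, counting letters forces
--       w' = bⁿ, v' = aⁿ, and the words (ab)ⁿ, (ba)ⁿ are conjugate.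

open import Defs
open import Data.Nat using (ℕ; zero; suc; _+_; _≤_; _<_; z≤n; s≤s)
open import Data.Nat.Properties
  using (≤-antisym; +-suc; +-comm; +-cancelˡ-≡; suc-injective; 1+n≰n)
open import Data.Fin using (Fin; _≟_)
open import Data.Fin.Permutation.Components using (transpose; transpose-inverse)
open import Data.List using ([]; _∷_; [_]; _++_; concat; filter; length; replicate; map)
open import Data.List.Properties
  using (++-assoc; ++-identityʳ; length-++; map-++; concat-++; length-filter;
         filter-++; filter-accept; filter-reject)
open import Data.Product using (∃-syntax; _×_; _,_)
open import Data.Empty using (⊥-elim)
open import Function using (_∘_)
open import Relation.Nullary using (yes; no; ¬_)
open import Relation.Binary.PropositionalEquality using (_≡_; refl; sym; trans; cong; cong₂; subst; subst₂; module ≡-Reasoning)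
open ≡-Reasoning

module _ {k : ℕ} where

  private
    W = Word k

  _∼ₚ_ : W → W → Set
  u ∼ₚ v = ∀ α → occ α u ≡ occ α v

  occ-here : ∀ α (w : W) → occ α (α ∷ w) ≡ suc (occ α w)
  occ-here α w = cong length (filter-accept (_≟ α) refl)

  occ-there : ∀ α {x} (w : W) → ¬ x ≡ α → occ α (x ∷ w) ≡ occ α w
  occ-there α w x≢α = cong length (filter-reject (_≟ α) x≢α)

  occ-++ : ∀ α (xs ys : W) → occ α (xs ++ ys) ≡ occ α xs + occ α ys
  occ-++ α xs ys = trans (cong length (filter-++ (_≟ α) xs ys)) (length-++ (filter (_≟ α) xs))

  occ-swap : ∀ α (xs ys : W) → occ α (xs ++ ys) ≡ occ α (ys ++ xs)
  occ-swap α xs ys = begin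
    occ α (xs ++ ys)      ≡⟨ occ-++ α xs ys ⟩
    occ α xs + occ α ys   ≡⟨ +-comm (occ α xs) (occ α ys) ⟩
    occ α ys + occ α xs   ≡⟨ occ-++ α ys xs ⟨
    occ α (ys ++ xs)      ∎

  occ≤length : ∀ α (w : W) → occ α w ≤ length w
  occ≤length α = length-filter (_≟ α)

  occ-complete : ∀ α (w : W) → occ α w ≡ length w → w ≡ replicate (length w) α
  occ-complete α [] _ = refl
  occ-complete α (x ∷ w) eq with x ≟ α
  ... | yes refl = cong (x ∷_) (occ-complete α w (suc-injective eq))
  ... | no _     = ⊥-elim (1+n≰n (subst (_≤ length w) eq (occ≤length α w)))

  occ-singleton : ∀ {α x : Fin k} → occ α [ x ] ≡ 1 → x ≡ α
  occ-singleton {α} {x} eq with x ≟ α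
  ... | yes x≡α = x≡α
  ... | no _    with () ← eq

  split-at : ∀ z (v : W) → 0 < occ z v → ∃[ xs ] ∃[ ys ] (v ≡ xs ++ z ∷ ys)
  split-at z (x ∷ v) pos with x ≟ z
  ... | yes refl = [] , v , refl
  ... | no _     with xs , ys , eq ← split-at z v pos = x ∷ xs , ys , cong (x ∷_) eq

  ∼ₚ-length : ∀ {u v : W} → u ∼ₚ v → length u ≡ length v
  ∼ₚ-length {[]}    {[]}    _ = refl
  ∼ₚ-length {[]}    {z ∷ v} h with () ← trans (h z) (occ-here z v)
  ∼ₚ-length {z ∷ u} {v}     h
    with xs , ys , refl ← split-at z v (subst (0 <_) (trans (sym (occ-here z u)) (h z)) (s≤s z≤n)) =
    begin
      suc (length u)                ≡⟨ cong suc (∼ₚ-length {u} {ys ++ xs} u∼ys++xs) ⟩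
      suc (length (ys ++ xs))       ≡⟨ cong suc (length-++ ys) ⟩
      suc (length ys + length xs)   ≡⟨ cong suc (+-comm (length ys) (length xs)) ⟩
      suc (length xs + length ys)   ≡⟨ +-suc (length xs) (length ys) ⟨
      length xs + length (z ∷ ys)   ≡⟨ length-++ xs ⟨
      length (xs ++ z ∷ ys)         ∎
    where
      -- Removing the chosen occurrence of z from both sides.
      u∼ys++xs : u ∼ₚ (ys ++ xs)
      u∼ys++xs α = +-cancelˡ-≡ (occ α [ z ]) (occ α u) (occ α (ys ++ xs)) (begin
        occ α [ z ] + occ α u          ≡⟨ occ-++ α [ z ] u ⟨
        occ α (z ∷ u)                  ≡⟨ h α ⟩
        occ α (xs ++ z ∷ ys)           ≡⟨ occ-swap α xs (z ∷ ys) ⟩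
        occ α (z ∷ ys ++ xs)           ≡⟨ occ-++ α [ z ] (ys ++ xs) ⟩
        occ α [ z ] + occ α (ys ++ xs) ∎)

  conjugate-refl : ∀ (u : W) → Conjugate u u
  conjugate-refl u = [] , u , refl , sym (++-identityʳ u)

  conjugate-sym : ∀ {u v : W} → Conjugate u v → Conjugate v u
  conjugate-sym (x , y , u≡xy , v≡yx) = y , x , v≡yx , u≡xy

  conjugate-∼ₚ : ∀ {u v : W} → Conjugate u v → u ∼ₚ v
  conjugate-∼ₚ (x , y , refl , refl) α = occ-swap α x y

  -- Transitivity goes through rotations: the conjugates of u are exactly
  -- the words rotⁿ n u obtained by moving the first letter to the end n times.
  rot : W → W
  rot []      = []
  rot (x ∷ w) = w ++ [ x ]

  rotⁿ : ℕ → W → W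
  rotⁿ zero    w = w
  rotⁿ (suc n) w = rotⁿ n (rot w)

  rotⁿ-+ : ∀ m n (u : W) → rotⁿ (m + n) u ≡ rotⁿ n (rotⁿ m u)
  rotⁿ-+ zero    n u = refl
  rotⁿ-+ (suc m) n u = rotⁿ-+ m n (rot u)

  rotⁿ-suc : ∀ n (u : W) → rotⁿ (suc n) u ≡ rot (rotⁿ n u)
  rotⁿ-suc zero    u = refl
  rotⁿ-suc (suc n) u = rotⁿ-suc n (rot u)

  rotⁿ-++ : ∀ (xs ys : W) → rotⁿ (length xs) (xs ++ ys) ≡ ys ++ xs
  rotⁿ-++ []       ys = sym (++-identityʳ ys)
  rotⁿ-++ (x ∷ xs) ys = begin
    rotⁿ (length xs) ((xs ++ ys) ++ [ x ]) ≡⟨ cong (rotⁿ (length xs)) (++-assoc xs ys [ x ]) ⟩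
    rotⁿ (length xs) (xs ++ ys ++ [ x ])   ≡⟨ rotⁿ-++ xs (ys ++ [ x ]) ⟩
    (ys ++ [ x ]) ++ xs                    ≡⟨ ++-assoc ys [ x ] xs ⟩
    ys ++ x ∷ xs                           ∎

  rotⁿ-conjugate : ∀ n (u : W) → Conjugate u (rotⁿ n u)
  rotⁿ-conjugate zero    u = conjugate-refl u
  rotⁿ-conjugate (suc n) u with rotⁿ-conjugate n u
  ... | x , c ∷ y , u≡xy , rot≡yx =
    x ++ [ c ] , y , trans u≡xy (sym (++-assoc x [ c ] y)) ,
    trans (rotⁿ-suc n u) (trans (cong rot rot≡yx) (++-assoc y x [ c ]))
  ... | [] , [] , u≡xy , rot≡yx =
    [] , [] , u≡xy , trans (rotⁿ-suc n u) (cong rot rot≡yx)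
  ... | c ∷ x , [] , u≡xy , rot≡yx =
    [ c ] , x , trans u≡xy (++-identityʳ (c ∷ x)) ,
    trans (rotⁿ-suc n u) (cong rot rot≡yx)

  conjugate-trans : ∀ {u v w : W} → Conjugate u v → Conjugate v w → Conjugate u w
  conjugate-trans {u} (x , y , refl , refl) (x′ , y′ , yx≡x′y′ , refl) =
    subst (Conjugate u) rotation (rotⁿ-conjugate (length x + length x′) u)
    where
      rotation : rotⁿ (length x + length x′) (x ++ y) ≡ y′ ++ x′
      rotation = begin
        rotⁿ (length x + length x′) (x ++ y)   ≡⟨ rotⁿ-+ (length x) (length x′) (x ++ y) ⟩
        rotⁿ (length x′) (rotⁿ (length x) (x ++ y)) ≡⟨ cong (rotⁿ (length x′)) (rotⁿ-++ x y) ⟩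
        rotⁿ (length x′) (y ++ x)              ≡⟨ cong (rotⁿ (length x′)) yx≡x′y′ ⟩
        rotⁿ (length x′) (x′ ++ y′)            ≡⟨ rotⁿ-++ x′ y′ ⟩
        y′ ++ x′                               ∎

  shift-conjugate : ∀ {a} {u v : W} → u ++ [ a ] ≡ a ∷ v → Conjugate u v
  shift-conjugate {u = []}    refl = conjugate-refl []
  shift-conjugate {u = c ∷ u} refl = [ c ] , u , refl , refl

  apply-++ : ∀ (f : Morphism k) (xs ys : W) → apply f (xs ++ ys) ≡ apply f xs ++ apply f ys
  apply-++ f xs ys = trans (cong concat (map-++ f xs ys)) (sym (concat-++ (map f xs) (map f ys)))

  apply-conjugate : ∀ (f : Morphism k) {u v : W} → Conjugate u v → Conjugate (apply f u) (apply f v)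
  apply-conjugate f (x , y , refl , refl) = apply f x , apply f y , apply-++ f x y , apply-++ f y x

  ψ-shift : ∀ a (w : W) → apply (ψ a) w ++ [ a ] ≡ a ∷ apply (ψ̄ a) w
  ψ-shift a []      = refl
  ψ-shift a (x ∷ w) with x ≟ a
  ... | yes _ = cong (a ∷_) (ψ-shift a w)
  ... | no _  = cong (λ t → a ∷ x ∷ t) (ψ-shift a w)

  ψ-ψ̄-conjugate : ∀ a (w : W) → Conjugate (apply (ψ a) w) (apply (ψ̄ a) w)
  ψ-ψ̄-conjugate a w = shift-conjugate (ψ-shift a w)

  -- Letter counts in ψ_a(w): every letter of w contributes one a.
  occ-ψ-self : ∀ a (w : W) → occ a (apply (ψ a) w) ≡ length w
  occ-ψ-self a []      = refl
  occ-ψ-self a (x ∷ w) with x ≟ a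
  ... | yes _   = trans (occ-here a _) (cong suc (occ-ψ-self a w))
  ... | no x≢a  = trans (occ-here a _) (cong suc (trans (occ-there a _ x≢a) (occ-ψ-self a w)))

  occ-ψ-other : ∀ a y (w : W) → ¬ y ≡ a → occ y (apply (ψ a) w) ≡ occ y w
  occ-ψ-other a y []      y≢a = refl
  occ-ψ-other a y (x ∷ w) y≢a with x ≟ a
  ... | yes refl = trans (occ-there y _ a≢y) (trans (occ-ψ-other a y w y≢a) (sym (occ-there y w a≢y)))
    where a≢y = y≢a ∘ sym
  ... | no _     = begin
    occ y (a ∷ x ∷ apply (ψ a) w)       ≡⟨ occ-there y _ (y≢a ∘ sym) ⟩
    occ y (x ∷ apply (ψ a) w)           ≡⟨ occ-++ y [ x ] _ ⟩
    occ y [ x ] + occ y (apply (ψ a) w) ≡⟨ cong (occ y [ x ] +_) (occ-ψ-other a y w y≢a) ⟩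
    occ y [ x ] + occ y w               ≡⟨ occ-++ y [ x ] w ⟨
    occ y (x ∷ w)                       ∎

  -- |ψ_a(w)| = 2|w| − |w|_a: letters other than a are doubled.
  length-ψ : ∀ a (w : W) → length (apply (ψ a) w) + occ a w ≡ length w + length w
  length-ψ a []      = refl
  length-ψ a (x ∷ w) with x ≟ a
  ... | yes _ = begin
    suc (ℓ + suc (occ a w))   ≡⟨ cong suc (+-suc ℓ (occ a w)) ⟩
    suc (suc (ℓ + occ a w))   ≡⟨ cong (suc ∘ suc) (length-ψ a w) ⟩
    suc (suc (n + n))         ≡⟨ cong suc (+-suc n n) ⟨
    suc n + suc n             ∎
    where ℓ = length (apply (ψ a) w)
          n = length w
  ... | no _  = begin
    suc (suc (ℓ + occ a w))   ≡⟨ cong (suc ∘ suc) (length-ψ a w) ⟩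
    suc (suc (n + n))         ≡⟨ cong suc (+-suc n n) ⟨
    suc n + suc n             ∎
    where ℓ = length (apply (ψ a) w)
          n = length w

  alternate : Fin k → Fin k → ℕ → W
  alternate a b zero    = []
  alternate a b (suc n) = a ∷ b ∷ alternate a b n

  ψ-replicate : ∀ a b n → ¬ b ≡ a → apply (ψ a) (replicate n b) ≡ alternate a b n
  ψ-replicate a b zero    b≢a = refl
  ψ-replicate a b (suc n) b≢a with b ≟ a
  ... | yes b≡a = ⊥-elim (b≢a b≡a)
  ... | no _    = cong (λ t → a ∷ b ∷ t) (ψ-replicate a b n b≢a)

  alternate-shift : ∀ a b n → alternate a b n ++ [ a ] ≡ a ∷ alternate b a n
  alternate-shift a b zero    = refl
  alternate-shift a b (suc n) = cong (λ t → a ∷ b ∷ t) (alternate-shift a b n)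

  θ-transpose : ∀ a b (x : Fin k) → θ a b x ≡ [ transpose a b x ]
  θ-transpose a b x with x ≟ a
  ... | yes _ = refl
  ... | no _  with x ≟ b
  ...   | yes _ = refl
  ...   | no _  = refl

  apply-θ : ∀ a b (w : W) → apply (θ a b) w ≡ map (transpose a b) w
  apply-θ a b []      = refl
  apply-θ a b (x ∷ w) = cong₂ _++_ (θ-transpose a b x) (apply-θ a b w)

  transpose-injective : ∀ (a b : Fin k) {x y} → transpose a b x ≡ transpose a b y → x ≡ y
  transpose-injective a b {x} {y} eq = begin
    x                             ≡⟨ transpose-inverse b a ⟨
    transpose b a (transpose a b x) ≡⟨ cong (transpose b a) eq ⟩
    transpose b a (transpose a b y) ≡⟨ transpose-inverse b a ⟩
    y                             ∎

  map-ψ : ∀ (g : Fin k → Fin k) → (∀ {x y} → g x ≡ g y → x ≡ y) →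
          ∀ c (w : W) → map g (apply (ψ c) w) ≡ apply (ψ (g c)) (map g w)
  map-ψ g g-inj c []      = refl
  map-ψ g g-inj c (x ∷ w) with x ≟ c | g x ≟ g c
  ... | yes _    | yes _     = cong (g c ∷_) (map-ψ g g-inj c w)
  ... | yes refl | no gx≢gx  = ⊥-elim (gx≢gx refl)
  ... | no x≢c   | yes gx≡gc = ⊥-elim (x≢c (g-inj gx≡gc))
  ... | no _     | no _      = cong (λ t → g c ∷ g x ∷ t) (map-ψ g g-inj c w)

  data Standard : W → Set where
    letter : ∀ x → Standard [ x ]
    ψ-step : ∀ a {w} → Standard w → Standard (apply (ψ a) w)

  standard-rename : ∀ (g : Fin k → Fin k) → (∀ {x y} → g x ≡ g y → x ≡ y) →
                    ∀ {w} → Standard w → Standard (map g w)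
  standard-rename g g-inj (letter x)       = letter (g x)
  standard-rename g g-inj (ψ-step a {w} s) =
    subst Standard (sym (map-ψ g g-inj a w)) (ψ-step (g a) (standard-rename g g-inj s))

  standard-form : ∀ {f : Morphism k} → Episturmian f → ∀ x →
                  ∃[ w ] (Standard w × Conjugate (f x) w)
  standard-form ep-id x = [ x ] , letter x , conjugate-refl [ x ]
  standard-form (ep-ψ a e) x with w , s , c ← standard-form e x =
    apply (ψ a) w , ψ-step a s , apply-conjugate (ψ a) c
  standard-form (ep-ψ̄ a e) x with w , s , c ← standard-form e x =
    apply (ψ a) w , ψ-step a s ,
    conjugate-trans (apply-conjugate (ψ̄ a) c) (conjugate-sym (ψ-ψ̄-conjugate a w))
  standard-form (ep-θ a b e) x with w , s , c ← standard-form e x =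
    map (transpose a b) w , standard-rename (transpose a b) (transpose-injective a b) s ,
    subst (Conjugate _) (apply-θ a b w) (apply-conjugate (θ a b) c)

  ∼ₚ-singleton : ∀ {x : Fin k} (v : W) → [ x ] ∼ₚ v → v ≡ [ x ]
  ∼ₚ-singleton {x} []          h with () ← ∼ₚ-length {[ x ]} {[]} h
  ∼ₚ-singleton (y ∷ [])    h = cong [_] (sym (occ-singleton (trans (h y) (occ-here y []))))
  ∼ₚ-singleton {x} (y ∷ z ∷ v) h with () ← ∼ₚ-length {[ x ]} {y ∷ z ∷ v} h

  ψ-∼ₚ-cancel : ∀ a (u v : W) → apply (ψ a) u ∼ₚ apply (ψ a) v → u ∼ₚ v
  ψ-∼ₚ-cancel a u v h α with α ≟ a
  ... | no α≢a  = trans (sym (occ-ψ-other a α u α≢a)) (trans (h α) (occ-ψ-other a α v α≢a))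
  ... | yes refl = +-cancelˡ-≡ (length (apply (ψ a) u)) (occ a u) (occ a v) (begin
    length (apply (ψ a) u) + occ a u ≡⟨ length-ψ a u ⟩
    length u + length u              ≡⟨ cong₂ _+_ |u|≡|v| |u|≡|v| ⟩
    length v + length v              ≡⟨ length-ψ a v ⟨
    length (apply (ψ a) v) + occ a v ≡⟨ cong (_+ occ a v) (∼ₚ-length {apply (ψ a) u} {apply (ψ a) v} h) ⟨
    length (apply (ψ a) u) + occ a v ∎)
    where |u|≡|v| = trans (sym (occ-ψ-self a u)) (trans (h a) (occ-ψ-self a v))

  -- If ψ_a(u) and ψ_b(v) have the same Parikh vector with a ≠ b, then
  -- u = bⁿ and v = aⁿ, so the two words are (ab)ⁿ and (ba)ⁿ.
  ψ-distinct : ∀ {a b} (u v : W) → ¬ a ≡ b → apply (ψ a) u ∼ₚ apply (ψ b) v →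
               Conjugate (apply (ψ a) u) (apply (ψ b) v)
  ψ-distinct {a} {b} u v a≢b h =
    subst₂ Conjugate (sym ψu≡alt) (sym ψv≡alt) (shift-conjugate (alternate-shift a b (length u)))
    where
      b≢a = a≢b ∘ sym
      |u|≡|v|ₐ : length u ≡ occ a v
      |u|≡|v|ₐ = trans (sym (occ-ψ-self a u)) (trans (h a) (occ-ψ-other b a v a≢b))
      |v|≡|u|ᵦ : length v ≡ occ b u
      |v|≡|u|ᵦ = trans (sym (occ-ψ-self b v)) (trans (sym (h b)) (occ-ψ-other a b u b≢a))
      |u|≡|v| : length u ≡ length v
      |u|≡|v| = ≤-antisym (subst (_≤ length v) (sym |u|≡|v|ₐ) (occ≤length a v))
                          (subst (_≤ length u) (sym |v|≡|u|ᵦ) (occ≤length b u))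
      ψu≡alt : apply (ψ a) u ≡ alternate a b (length u)
      ψu≡alt = trans (cong (apply (ψ a)) (occ-complete b u (trans (sym |v|≡|u|ᵦ) (sym |u|≡|v|))))
                     (ψ-replicate a b (length u) b≢a)
      ψv≡alt : apply (ψ b) v ≡ alternate b a (length u)
      ψv≡alt = trans (cong (apply (ψ b)) (occ-complete a v (trans (sym |u|≡|v|ₐ) |u|≡|v|)))
                     (trans (ψ-replicate b a (length v) a≢b) (cong (alternate b a) (sym |u|≡|v|)))

  standard-unique : ∀ {u v : W} → Standard u → Standard v → u ∼ₚ v → Conjugate u v
  standard-unique {v = v} (letter x) _ h =
    subst (Conjugate [ x ]) (sym (∼ₚ-singleton v h)) (conjugate-refl [ x ])
  standard-unique {u} (ψ-step a _) (letter y) h =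
    subst (λ t → Conjugate t [ y ]) (sym (∼ₚ-singleton u (sym ∘ h))) (conjugate-refl [ y ])
  standard-unique (ψ-step a {u} su) (ψ-step b {v} sv) h with a ≟ b
  ... | yes refl = apply-conjugate (ψ a) (standard-unique su sv (ψ-∼ₚ-cancel a u v h))
  ... | no a≢b   = ψ-distinct u v a≢b h

proposition5p6 : (k : ℕ) (u v : Word k) →
    CEpichristoffel u → CEpichristoffel v →
    ((α : Fin k) → occ α u ≡ occ α v) →
    Conjugate u v
proposition5p6 k u v (f , x , episturmian-f , refl) (g , y , episturmian-g , refl) h
  with w  , standard-w  , fx~w  ← standard-form episturmian-f x
     | w′ , standard-w′ , gy~w′ ← standard-form episturmian-g y =
  conjugate-trans fx~w (conjugate-trans (standard-unique standard-w standard-w′ w∼w′) (conjugate-sym gy~w′))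
  where
    w∼w′ : w ∼ₚ w′
    w∼w′ α = trans (sym (conjugate-∼ₚ fx~w α)) (trans (h α) (conjugate-∼ₚ gy~w′ α))
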